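{- Let $S_0=\begin{pmatrix}0&1\\1&0\end{pmatrix}$ and $M_1=\begin{pmatrix}1_2&0\\S_0&1_2\end{pmatrix}$, $M_2=\begin{pmatrix}1_2&S_0\\0&1_2\end{pmatrix}$, $M_3=\begin{pmatrix}1_2&-1_2-S_0\\1_2&-S_0\end{pmatrix}$. Then $\{1_4,M_1,M_2,M_3\}$ is a complete set of representatives of the double coset space $\Gamma_0^0(2)\backslash Sp(2,\mathbb Z)/\Gamma_{\mathrm{diag}}$.
   Context: $\Gamma_0^0(2)=\{\begin{pmatrix}A&B\\C&D\end{pmatrix}\in Sp(2,\mathbb Z):B\equiv C\equiv0\bmod2\}$. $\Gamma_{\mathrm{diag}}$ is the image of $SL_2(\mathbb Z)\times SL_2(\mathbb Z)$ in $Sp(2,\mathbb Z)$ under $\iota\big(\begin{pmatrix}a_1&b_1\\c_1&d_1\end{pmatrix},\begin{pmatrix}a_2&b_2\\c_2&d_2\end{pmatrix}\big)=\begin{pmatrix}a_1&0&b_1&0\\0&a_2&0&b_2\\c_1&0&d_1&0\\0&c_2&0&d_2\end{pmatrix}$. -}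

module Defs where

open import Data.Integer using (ℤ; +_; -_; _+_; _*_; _-_)
open import Data.Integer.Divisibility using (_∣_)
open import Data.Fin using (Fin; zero; suc)
open import Data.Vec using (Vec; []; _∷_; lookup)
open import Data.Product using (_×_; Σ; ∃; _,_)
open import Relation.Binary.PropositionalEquality using (_≡_)
open import Relation.Nullary using (¬_)

Mat : Set
Mat = Fin 4 → Fin 4 → ℤ

-- matrix equality: entrywise (no function extensionality available)
_≈_ : Mat → Mat → Set
A ≈ B = ∀ i j → A i j ≡ B i j
infix 4 _≈_

fromRows : Vec (Vec ℤ 4) 4 → Mat
fromRows v i j = lookup (lookup v i) j

sum4 : (Fin 4 → ℤ) → ℤ
sum4 f = f zero + f (suc zero) + f (suc (suc zero)) + f (suc (suc (suc zero)))

_·_ : Mat → Mat → Mat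
(A · B) i j = sum4 (λ k → A i k * B k j)
infixl 7 _·_

transpose : Mat → Mat
transpose A i j = A j i

0ℤ 1ℤ : ℤ
0ℤ = + 0
1ℤ = + 1

J : Mat
J = fromRows
  ( (0ℤ ∷ 0ℤ ∷ 1ℤ ∷ 0ℤ ∷ [])
  ∷ (0ℤ ∷ 0ℤ ∷ 0ℤ ∷ 1ℤ ∷ [])
  ∷ (- 1ℤ ∷ 0ℤ ∷ 0ℤ ∷ 0ℤ ∷ [])
  ∷ (0ℤ ∷ - 1ℤ ∷ 0ℤ ∷ 0ℤ ∷ [])
  ∷ [])

IsSp : Mat → Set
IsSp M = transpose M · J · M ≈ J

-- block of an index: 0,1 ↦ first block (A,B rows / A,C columns); 2,3 ↦ second
block : Fin 4 → Fin 2
block zero = zero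
block (suc zero) = zero
block (suc (suc _)) = suc zero

-- Γ₀⁰(2) = { (A B ; C D) ∈ Sp(2,ℤ) : B ≡ C ≡ 0 mod 2 }
-- (B and C are exactly the entries whose row and column lie in different blocks)
InΓ₀⁰2 : Mat → Set
InΓ₀⁰2 M = IsSp M × (∀ i j → ¬ (block i ≡ block j) → + 2 ∣ M i j)

ι : (a₁ b₁ c₁ d₁ a₂ b₂ c₂ d₂ : ℤ) → Mat
ι a₁ b₁ c₁ d₁ a₂ b₂ c₂ d₂ = fromRows
  ( (a₁ ∷ 0ℤ ∷ b₁ ∷ 0ℤ ∷ [])
  ∷ (0ℤ ∷ a₂ ∷ 0ℤ ∷ b₂ ∷ [])
  ∷ (c₁ ∷ 0ℤ ∷ d₁ ∷ 0ℤ ∷ [])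
  ∷ (0ℤ ∷ c₂ ∷ 0ℤ ∷ d₂ ∷ [])
  ∷ [])

InΓdiag : Mat → Set
InΓdiag M = ∃ λ a₁ → ∃ λ b₁ → ∃ λ c₁ → ∃ λ d₁ → ∃ λ a₂ → ∃ λ b₂ → ∃ λ c₂ → ∃ λ d₂ →
  (a₁ * d₁ - b₁ * c₁ ≡ 1ℤ) × (a₂ * d₂ - b₂ * c₂ ≡ 1ℤ) ×
  (M ≈ ι a₁ b₁ c₁ d₁ a₂ b₂ c₂ d₂)

SameDoubleCoset : Mat → Mat → Set
SameDoubleCoset g h = ∃ λ γ → ∃ λ δ → InΓ₀⁰2 γ × InΓdiag δ × (g ≈ γ · h · δ)

rep : Fin 4 → Mat
rep zero = fromRows
  ( (1ℤ ∷ 0ℤ ∷ 0ℤ ∷ 0ℤ ∷ [])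
  ∷ (0ℤ ∷ 1ℤ ∷ 0ℤ ∷ 0ℤ ∷ [])
  ∷ (0ℤ ∷ 0ℤ ∷ 1ℤ ∷ 0ℤ ∷ [])
  ∷ (0ℤ ∷ 0ℤ ∷ 0ℤ ∷ 1ℤ ∷ [])
  ∷ [])
rep (suc zero) = fromRows
  ( (1ℤ ∷ 0ℤ ∷ 0ℤ ∷ 0ℤ ∷ [])
  ∷ (0ℤ ∷ 1ℤ ∷ 0ℤ ∷ 0ℤ ∷ [])
  ∷ (0ℤ ∷ 1ℤ ∷ 1ℤ ∷ 0ℤ ∷ [])
  ∷ (1ℤ ∷ 0ℤ ∷ 0ℤ ∷ 1ℤ ∷ [])
  ∷ [])
rep (suc (suc zero)) = fromRows
  ( (1ℤ ∷ 0ℤ ∷ 0ℤ ∷ 1ℤ ∷ [])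
  ∷ (0ℤ ∷ 1ℤ ∷ 1ℤ ∷ 0ℤ ∷ [])
  ∷ (0ℤ ∷ 0ℤ ∷ 1ℤ ∷ 0ℤ ∷ [])
  ∷ (0ℤ ∷ 0ℤ ∷ 0ℤ ∷ 1ℤ ∷ [])
  ∷ [])
rep (suc (suc (suc zero))) = fromRows
  ( (1ℤ ∷ 0ℤ ∷ - 1ℤ ∷ - 1ℤ ∷ [])
  ∷ (0ℤ ∷ 1ℤ ∷ - 1ℤ ∷ - 1ℤ ∷ [])
  ∷ (1ℤ ∷ 0ℤ ∷ 0ℤ ∷ - 1ℤ ∷ [])
  ∷ (0ℤ ∷ 1ℤ ∷ - 1ℤ ∷ 0ℤ ∷ [])
  ∷ [])

{-# OPTIONS --safe #-}

-- Reduction mod 2 sends Γ₀⁰(2) to block-diagonal matrices, so the double cosets can be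
-- compared in the finite group Sp(2,𝔽₂).  The parities of the 2×2 minors of g in rows {0,1}
-- resp. {2,3} and columns {0,2} are invariants: right multiplication by ι(k₁, k₂) multiplies
-- them by det k₁ = 1, and left multiplication by γ ∈ Γ₀⁰(2) multiplies them mod 2 by the
-- determinant of a diagonal block of γ, which is odd because γ is symplectic.  The four
-- representatives realise the four possible values.  Conversely, for every symplectic g an
-- exhaustive search over Sp(2,𝔽₂) finds δ ∈ ι(SL₂(ℤ) × SL₂(ℤ)) such that g (rᵢ δ)⁻¹, where
-- rᵢ is the representative with the invariants of g, has even off-diagonal blocks.

module Submission where

open import Defs
open import Data.Nat.Base as ℕ using (zero; suc; parity; z≤n)
import Data.Nat.Properties as ℕ
open import Data.Nat.Divisibility as ℕ using (divides; _∣0; n∣n; ∣m∣n⇒∣m+n)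
open import Data.Integer.Base using (ℤ; +_; -[1+_]; _⊖_; ∣_∣; _+_; _*_; _-_; -_)
import Data.Integer.Properties as ℤ
open import Algebra.Properties.CommutativeSemigroup ℤ.+-commutativeSemigroup
  using () renaming (interchange to +-interchange)
open import Data.Integer.Divisibility using (_∣_)
open import Data.Integer.Tactic.RingSolver using (solve-∀)
open import Data.Parity.Base using (Parity; 0ℙ; 1ℙ)
  renaming (_+_ to infixl 6 _+₂_; _*_ to infixl 7 _*₂_)
import Data.Parity.Properties as ℙ
open import Data.Fin.Base using (Fin; zero; suc)
import Data.Fin.Properties as Fin
open import Data.Fin.Properties using (all?; any?)
open import Data.Vec.Base using (Vec; []; _∷_; lookup; tabulate)
open import Data.Vec.Properties using (lookup∘tabulate)
open import Data.Product.Base using (_×_; _,_; proj₁; proj₂; ∃)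
open import Data.Product.Properties using (≡-dec)
open import Function.Base using (_∘_)
open import Relation.Binary.Bundles using (Setoid)
import Relation.Binary.Reasoning.Setoid as SetoidReasoning
open import Relation.Binary.PropositionalEquality
  using (_≡_; refl; sym; trans; cong; cong₂; module ≡-Reasoning)
open import Relation.Nullary using (¬_; Dec; yes; no; map′; _×-dec_; _→-dec_; ¬?)
open import Relation.Nullary.Decidable using (from-yes)
open import Relation.Unary using (Decidable)

pattern 0F = zero
pattern 1F = suc zero
pattern 2F = suc (suc zero)
pattern 3F = suc (suc (suc zero))
pattern 4F = suc 3F
pattern 5F = suc 4F

1₄ : Mat
1₄ = rep 0F

≈-refl : ∀ {A} → A ≈ A
≈-refl _ _ = refl

≈-setoid : Setoid _ _
≈-setoid = record
  { Carrier       = Mat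
  ; _≈_           = _≈_
  ; isEquivalence = record
    { refl  = ≈-refl
    ; sym   = λ A≈B i j → sym (A≈B i j)
    ; trans = λ A≈B B≈C i j → trans (A≈B i j) (B≈C i j)
    }
  }

sum4-cong : ∀ {f g : Fin 4 → ℤ} → (∀ k → f k ≡ g k) → sum4 f ≡ sum4 g
sum4-cong f≡g = cong₂ _+_ (cong₂ _+_ (cong₂ _+_ (f≡g 0F) (f≡g 1F)) (f≡g 2F)) (f≡g 3F)

sum4-distribʳ : ∀ f c → sum4 f * c ≡ sum4 (λ k → f k * c)
sum4-distribʳ f c = distrib (f 0F) (f 1F) (f 2F) (f 3F) c
  where
  distrib : ∀ x₀ x₁ x₂ x₃ c → (x₀ + x₁ + x₂ + x₃) * c ≡ x₀ * c + x₁ * c + x₂ * c + x₃ * c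
  distrib = solve-∀

sum4-distribˡ : ∀ c f → c * sum4 f ≡ sum4 (λ k → c * f k)
sum4-distribˡ c f = distrib c (f 0F) (f 1F) (f 2F) (f 3F)
  where
  distrib : ∀ c x₀ x₁ x₂ x₃ → c * (x₀ + x₁ + x₂ + x₃) ≡ c * x₀ + c * x₁ + c * x₂ + c * x₃
  distrib = solve-∀

sum4-+ : ∀ f g → sum4 (λ k → f k + g k) ≡ sum4 f + sum4 g
sum4-+ f g =
  trans (cong (_+ (f 3F + g 3F))
    (trans (cong (_+ (f 2F + g 2F)) (+-interchange (f 0F) (g 0F) (f 1F) (g 1F)))
           (+-interchange (f 0F + f 1F) (g 0F + g 1F) (f 2F) (g 2F))))
    (+-interchange (f 0F + f 1F + f 2F) (g 0F + g 1F + g 2F) (f 3F) (g 3F))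

sum4-swap : ∀ (f : Fin 4 → Fin 4 → ℤ) →
            sum4 (λ k → sum4 (f k)) ≡ sum4 (λ l → sum4 (λ k → f k l))
sum4-swap f = begin
  sum4 (λ k → f k 0F + f k 1F + f k 2F + f k 3F)
    ≡⟨ sum4-+ (λ k → f k 0F + f k 1F + f k 2F) (λ k → f k 3F) ⟩
  sum4 (λ k → f k 0F + f k 1F + f k 2F) + column 3F
    ≡⟨ cong (_+ column 3F) (sum4-+ (λ k → f k 0F + f k 1F) (λ k → f k 2F)) ⟩
  sum4 (λ k → f k 0F + f k 1F) + column 2F + column 3F
    ≡⟨ cong (λ s → s + column 2F + column 3F) (sum4-+ (λ k → f k 0F) (λ k → f k 1F)) ⟩
  column 0F + column 1F + column 2F + column 3F
    ∎
  where open ≡-Reasoning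
        column = λ l → sum4 (λ k → f k l)

·-cong : ∀ {A A′ B B′} → A ≈ A′ → B ≈ B′ → A · B ≈ A′ · B′
·-cong A≈A′ B≈B′ i j = sum4-cong λ k → cong₂ _*_ (A≈A′ i k) (B≈B′ k j)

·-assoc : ∀ A B C → A · B · C ≈ A · (B · C)
·-assoc A B C i j = begin
  sum4 (λ k → sum4 (λ l → A i l * B l k) * C k j)
    ≡⟨ sum4-cong (λ k → sum4-distribʳ (λ l → A i l * B l k) (C k j)) ⟩
  sum4 (λ k → sum4 (λ l → A i l * B l k * C k j))
    ≡⟨ sum4-swap (λ k l → A i l * B l k * C k j) ⟩
  sum4 (λ l → sum4 (λ k → A i l * B l k * C k j))
    ≡⟨ sum4-cong (λ l → sum4-cong λ k → ℤ.*-assoc (A i l) (B l k) (C k j)) ⟩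
  sum4 (λ l → sum4 (λ k → A i l * (B l k * C k j)))
    ≡⟨ sum4-cong (λ l → sum4-distribˡ (A i l) (λ k → B l k * C k j)) ⟨
  sum4 (λ l → A i l * sum4 (λ k → B l k * C k j))
    ∎
  where open ≡-Reasoning

·-identityʳ : ∀ A → A · 1₄ ≈ A
·-identityʳ A i 0F = unit (A i 0F) (A i 1F) (A i 2F) (A i 3F)
  where unit : ∀ x₀ x₁ x₂ x₃ → x₀ * + 1 + x₁ * + 0 + x₂ * + 0 + x₃ * + 0 ≡ x₀
        unit = solve-∀
·-identityʳ A i 1F = unit (A i 0F) (A i 1F) (A i 2F) (A i 3F)
  where unit : ∀ x₀ x₁ x₂ x₃ → x₀ * + 0 + x₁ * + 1 + x₂ * + 0 + x₃ * + 0 ≡ x₁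
        unit = solve-∀
·-identityʳ A i 2F = unit (A i 0F) (A i 1F) (A i 2F) (A i 3F)
  where unit : ∀ x₀ x₁ x₂ x₃ → x₀ * + 0 + x₁ * + 0 + x₂ * + 1 + x₃ * + 0 ≡ x₂
        unit = solve-∀
·-identityʳ A i 3F = unit (A i 0F) (A i 1F) (A i 2F) (A i 3F)
  where unit : ∀ x₀ x₁ x₂ x₃ → x₀ * + 0 + x₁ * + 0 + x₂ * + 0 + x₃ * + 1 ≡ x₃
        unit = solve-∀

transpose-· : ∀ A B → transpose (A · B) ≈ transpose B · transpose A
transpose-· A B i j = sum4-cong λ k → ℤ.*-comm (A j k) (B k i)

IsSp-· : ∀ g h → IsSp g → IsSp h → IsSp (g · h)
IsSp-· g h g∈Sp h∈Sp = begin
  transpose (g · h) · J · (g · h) ≈⟨ ·-cong (·-cong (transpose-· g h) (≈-refl {J})) (≈-refl {g · h}) ⟩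
  hᵀ · gᵀ · J · (g · h)           ≈⟨ ·-cong (·-assoc hᵀ gᵀ J) (≈-refl {g · h}) ⟩
  hᵀ · (gᵀ · J) · (g · h)         ≈⟨ ·-assoc hᵀ (gᵀ · J) (g · h) ⟩
  hᵀ · (gᵀ · J · (g · h))         ≈⟨ ·-cong (≈-refl {hᵀ}) (·-assoc (gᵀ · J) g h) ⟨
  hᵀ · (gᵀ · J · g · h)           ≈⟨ ·-cong (≈-refl {hᵀ}) (·-cong g∈Sp (≈-refl {h})) ⟩
  hᵀ · (J · h)                    ≈⟨ ·-assoc hᵀ J h ⟨
  hᵀ · J · h                      ≈⟨ h∈Sp ⟩
  J                               ∎
  where open SetoidReasoning ≈-setoid
        gᵀ = transpose g
        hᵀ = transpose h

infix 4 _≈?_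

_≈?_ : ∀ A B → Dec (A ≈ B)
A ≈? B = all? λ i → all? λ j → A i j ℤ.≟ B i j

IsSp? : ∀ M → Dec (IsSp M)
IsSp? M = transpose M · J · M ≈? J

-- Reduction modulo 2

parityℤ : ℤ → Parity
parityℤ i = parity ∣ i ∣

parityℤ-neg : ∀ i → parityℤ (- i) ≡ parityℤ i
parityℤ-neg i = cong parity (ℤ.∣-i∣≡∣i∣ i)

parityℤ-* : ∀ i j → parityℤ (i * j) ≡ parityℤ i *₂ parityℤ j
parityℤ-* i j = trans (cong parity (ℤ.abs-* i j)) (ℙ.*-homo-* ∣ i ∣ ∣ j ∣)

parity-+-suc : ∀ m n → parity (m ℕ.+ n) ≡ parity (suc m) +₂ parity (suc n)
parity-+-suc m n = trans (cong (parity ∘ suc) (sym (ℕ.+-suc m n))) (ℙ.+-homo-+ (suc m) (suc n))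

parityℤ-⊖ : ∀ m n → parityℤ (m ⊖ n) ≡ parity m +₂ parity n
parityℤ-⊖ m       zero    = trans (cong parityℤ (ℤ.⊖-≥ {m} z≤n)) (sym (ℙ.+-identityʳ (parity m)))
parityℤ-⊖ zero    (suc n) = refl
parityℤ-⊖ (suc m) (suc n) = begin
  parityℤ (suc m ⊖ suc n)          ≡⟨ cong parityℤ (ℤ.[1+m]⊖[1+n]≡m⊖n m n) ⟩
  parityℤ (m ⊖ n)                  ≡⟨ parityℤ-⊖ m n ⟩
  parity m +₂ parity n             ≡⟨ ℙ.+-homo-+ m n ⟨
  parity (m ℕ.+ n)                 ≡⟨ parity-+-suc m n ⟩
  parity (suc m) +₂ parity (suc n) ∎
  where open ≡-Reasoning

parityℤ-+ : ∀ i j → parityℤ (i + j) ≡ parityℤ i +₂ parityℤ j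
parityℤ-+ (+ m)    (+ n)    = ℙ.+-homo-+ m n
parityℤ-+ (+ m)    -[1+ n ] = parityℤ-⊖ m (suc n)
parityℤ-+ -[1+ m ] (+ n)    = trans (parityℤ-⊖ n (suc m)) (ℙ.+-comm (parity n) _)
parityℤ-+ -[1+ m ] -[1+ n ] = parity-+-suc m n

parityℤ-- : ∀ i j → parityℤ (i - j) ≡ parityℤ i +₂ parityℤ j
parityℤ-- i j = trans (parityℤ-+ i (- j)) (cong (parityℤ i +₂_) (parityℤ-neg j))

-- `+ 2 ∣ i` unfolds to `2 ∣ ∣ i ∣` in ℕ.
parityℤ≡0ℙ⇒2∣ : ∀ i → parityℤ i ≡ 0ℙ → + 2 ∣ i
parityℤ≡0ℙ⇒2∣ i = even ∣ i ∣
  where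
  even : ∀ n → parity n ≡ 0ℙ → 2 ℕ.∣ n
  even zero          _  = 2 ∣0
  even (suc (suc n)) p₀ = ∣m∣n⇒∣m+n n∣n (even n p₀)

2∣⇒parityℤ≡0ℙ : ∀ i → + 2 ∣ i → parityℤ i ≡ 0ℙ
2∣⇒parityℤ≡0ℙ i = even ∣ i ∣
  where
  even : ∀ n → 2 ℕ.∣ n → parity n ≡ 0ℙ
  even _ (divides q refl) = trans (ℙ.*-homo-* q 2) (ℙ.*-zeroʳ (parity q))

Mat₂ : Set
Mat₂ = Fin 4 → Fin 4 → Parity

infix 4 _≈₂_
infixl 7 _⊙_

_≈₂_ : Mat₂ → Mat₂ → Set
P ≈₂ Q = ∀ i j → P i j ≡ Q i j

≈₂-refl : ∀ {P} → P ≈₂ P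
≈₂-refl _ _ = refl

reduce : Mat → Mat₂
reduce A i j = parityℤ (A i j)

reduce-cong : ∀ {A B} → A ≈ B → reduce A ≈₂ reduce B
reduce-cong A≈B i j = cong parityℤ (A≈B i j)

column₂ : Mat₂ → Fin 4 → Fin 4 → Parity
column₂ P j i = P i j

sum4₂ : (Fin 4 → Parity) → Parity
sum4₂ f = f 0F +₂ f 1F +₂ f 2F +₂ f 3F

sum4₂-cong : ∀ {f g : Fin 4 → Parity} → (∀ k → f k ≡ g k) → sum4₂ f ≡ sum4₂ g
sum4₂-cong f≡g = cong₂ _+₂_ (cong₂ _+₂_ (cong₂ _+₂_ (f≡g 0F) (f≡g 1F)) (f≡g 2F)) (f≡g 3F)

_⊙_ : Mat₂ → Mat₂ → Mat₂
(P ⊙ Q) i j = sum4₂ λ k → P i k *₂ Q k j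

⊙-cong : ∀ {P P′ Q Q′} → P ≈₂ P′ → Q ≈₂ Q′ → P ⊙ Q ≈₂ P′ ⊙ Q′
⊙-cong P≈P′ Q≈Q′ i j = sum4₂-cong λ k → cong₂ _*₂_ (P≈P′ i k) (Q≈Q′ k j)

parityℤ-sum4 : ∀ f → parityℤ (sum4 f) ≡ sum4₂ (parityℤ ∘ f)
parityℤ-sum4 f =
  trans (parityℤ-+ (f 0F + f 1F + f 2F) (f 3F)) (cong (_+₂ parityℤ (f 3F))
  (trans (parityℤ-+ (f 0F + f 1F) (f 2F)) (cong (_+₂ parityℤ (f 2F))
  (parityℤ-+ (f 0F) (f 1F)))))

reduce-· : ∀ A B → reduce (A · B) ≈₂ reduce A ⊙ reduce B
reduce-· A B i j =
  trans (parityℤ-sum4 λ k → A i k * B k j) (sum4₂-cong λ k → parityℤ-* (A i k) (B k j))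

ω : (Fin 4 → ℤ) → (Fin 4 → ℤ) → ℤ
ω u v = u 0F * v 2F + u 1F * v 3F - u 2F * v 0F - u 3F * v 1F

ω₂ : (Fin 4 → Parity) → (Fin 4 → Parity) → Parity
ω₂ u v = u 0F *₂ v 2F +₂ u 1F *₂ v 3F +₂ u 2F *₂ v 0F +₂ u 3F *₂ v 1F

ω₂-cong : ∀ {u u′ v v′} → (∀ k → u k ≡ u′ k) → (∀ k → v k ≡ v′ k) → ω₂ u v ≡ ω₂ u′ v′
ω₂-cong u≡u′ v≡v′ =
  cong₂ _+₂_ (cong₂ _+₂_ (cong₂ _+₂_ (term 0F 2F) (term 1F 3F)) (term 2F 0F)) (term 3F 1F)
  where term = λ k l → cong₂ _*₂_ (u≡u′ k) (v≡v′ l)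

parityℤ-ω : ∀ u v → parityℤ (ω u v) ≡ ω₂ (parityℤ ∘ u) (parityℤ ∘ v)
parityℤ-ω u v =
  trans (parityℤ-- (u 0F * v 2F + u 1F * v 3F - u 2F * v 0F) (u 3F * v 1F)) (cong₂ _+₂_
  (trans (parityℤ-- (u 0F * v 2F + u 1F * v 3F) (u 2F * v 0F)) (cong₂ _+₂_
  (trans (parityℤ-+ (u 0F * v 2F) (u 1F * v 3F)) (cong₂ _+₂_ (term 0F 2F) (term 1F 3F)))
  (term 2F 0F)))
  (term 3F 1F))
  where term = λ k l → parityℤ-* (u k) (v l)

ᵀJ-pairing : ∀ g i j → (transpose g · J · g) i j ≡ ω (λ k → g k i) (λ k → g k j)
ᵀJ-pairing g i j = pairing (g 0F i) (g 1F i) (g 2F i) (g 3F i) (g 0F j) (g 1F j) (g 2F j) (g 3F j)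
  where
  pairing : ∀ u₀ u₁ u₂ u₃ v₀ v₁ v₂ v₃ →
      (u₀ * + 0 + u₁ * + 0 + u₂ * - + 1 + u₃ * + 0) * v₀
    + (u₀ * + 0 + u₁ * + 0 + u₂ * + 0 + u₃ * - + 1) * v₁
    + (u₀ * + 1 + u₁ * + 0 + u₂ * + 0 + u₃ * + 0) * v₂
    + (u₀ * + 0 + u₁ * + 1 + u₂ * + 0 + u₃ * + 0) * v₃
    ≡ u₀ * v₂ + u₁ * v₃ - u₂ * v₀ - u₃ * v₁
  pairing = solve-∀

IsSp⇒ω₂ : ∀ g → IsSp g →
          ∀ i j → ω₂ (column₂ (reduce g) i) (column₂ (reduce g) j) ≡ parityℤ (J i j)
IsSp⇒ω₂ g g∈Sp i j = begin
  ω₂ (column₂ (reduce g) i) (column₂ (reduce g) j) ≡⟨ parityℤ-ω (λ k → g k i) (λ k → g k j) ⟨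
  parityℤ (ω (λ k → g k i) (λ k → g k j))          ≡⟨ cong parityℤ (ᵀJ-pairing g i j) ⟨
  parityℤ ((transpose g · J · g) i j)               ≡⟨ cong parityℤ (g∈Sp i j) ⟩
  parityℤ (J i j)                                   ∎
  where open ≡-Reasoning

Searchable : Set → Set₁
Searchable A = ∀ {P : A → Set} → Decidable P → Dec (∀ x → P x)

searchable-Parity : Searchable Parity
searchable-Parity P? =
  map′ (λ (p₀ , p₁) → λ { 0ℙ → p₀ ; 1ℙ → p₁ }) (λ p → p 0ℙ , p 1ℙ) (P? 0ℙ ×-dec P? 1ℙ)

searchable-Vec : ∀ {A} n → Searchable A → Searchable (Vec A n)
searchable-Vec zero    _        P? = map′ (λ { p [] → p }) (λ p → p []) (P? [])
searchable-Vec (suc n) search-A P? = map′ (λ { p (x ∷ xs) → p x xs }) (λ p x xs → p (x ∷ xs))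
  (search-A λ x → searchable-Vec n search-A λ xs → P? (x ∷ xs))

-- Invariants of the double cosets

minor : Fin 4 → Fin 4 → Mat → ℤ
minor r s X = X r 0F * X s 2F - X r 2F * X s 0F

minor₂ : Fin 4 → Fin 4 → Mat₂ → Parity
minor₂ r s P = P r 0F *₂ P s 2F +₂ P r 2F *₂ P s 0F

invariant₂ : Mat₂ → Parity × Parity
invariant₂ P = minor₂ 0F 1F P , minor₂ 2F 3F P

repOf : Parity × Parity → Fin 4
repOf (0ℙ , 0ℙ) = 0F
repOf (0ℙ , 1ℙ) = 1F
repOf (1ℙ , 0ℙ) = 2F
repOf (1ℙ , 1ℙ) = 3F

repOf-invariant₂ : ∀ i → repOf (invariant₂ (reduce (rep i))) ≡ i
repOf-invariant₂ 0F = refl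
repOf-invariant₂ 1F = refl
repOf-invariant₂ 2F = refl
repOf-invariant₂ 3F = refl

minor-cong : ∀ r s {A B} → A ≈ B → minor r s A ≡ minor r s B
minor-cong r s A≈B = cong₂ _-_ (cong₂ _*_ (A≈B r 0F) (A≈B s 2F)) (cong₂ _*_ (A≈B r 2F) (A≈B s 0F))

invariant₂-cong : ∀ {P Q} → P ≈₂ Q → invariant₂ P ≡ invariant₂ Q
invariant₂-cong P≈Q = cong₂ _,_ (minor₂-cong 0F 1F) (minor₂-cong 2F 3F)
  where
  minor₂-cong = λ r s →
    cong₂ _+₂_ (cong₂ _*₂_ (P≈Q r 0F) (P≈Q s 2F)) (cong₂ _*₂_ (P≈Q r 2F) (P≈Q s 0F))

parityℤ-minor : ∀ r s X → parityℤ (minor r s X) ≡ minor₂ r s (reduce X)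
parityℤ-minor r s X = trans (parityℤ-- (X r 0F * X s 2F) (X r 2F * X s 0F))
  (cong₂ _+₂_ (parityℤ-* (X r 0F) (X s 2F)) (parityℤ-* (X r 2F) (X s 0F)))

minor-·-ι : ∀ r s X a₁ b₁ c₁ d₁ a₂ b₂ c₂ d₂ →
            minor r s (X · ι a₁ b₁ c₁ d₁ a₂ b₂ c₂ d₂) ≡ minor r s X * (a₁ * d₁ - b₁ * c₁)
minor-·-ι r s X a₁ b₁ c₁ d₁ _ _ _ _ =
  identity (X r 0F) (X r 1F) (X r 2F) (X r 3F) (X s 0F) (X s 1F) (X s 2F) (X s 3F) a₁ b₁ c₁ d₁
  where
  identity : ∀ x₀ x₁ x₂ x₃ y₀ y₁ y₂ y₃ a b c d →
      (x₀ * a + x₁ * + 0 + x₂ * c + x₃ * + 0) * (y₀ * b + y₁ * + 0 + y₂ * d + y₃ * + 0)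
    - (x₀ * b + x₁ * + 0 + x₂ * d + x₃ * + 0) * (y₀ * a + y₁ * + 0 + y₂ * c + y₃ * + 0)
    ≡ (x₀ * y₂ - x₂ * y₀) * (a * d - b * c)
  identity = solve-∀

minor₂-·-Γdiag : ∀ r s X δ → InΓdiag δ → minor₂ r s (reduce (X · δ)) ≡ minor₂ r s (reduce X)
minor₂-·-Γdiag r s X δ (a₁ , b₁ , c₁ , d₁ , a₂ , b₂ , c₂ , d₂ , det₁≡1 , _ , δ≈ι) = begin
  minor₂ r s (reduce (X · δ))                 ≡⟨ parityℤ-minor r s (X · δ) ⟨
  parityℤ (minor r s (X · δ))                 ≡⟨ cong parityℤ (minor-cong r s (·-cong (≈-refl {X}) δ≈ι)) ⟩
  parityℤ (minor r s (X · ι₁₂))               ≡⟨ cong parityℤ (minor-·-ι r s X a₁ b₁ c₁ d₁ a₂ b₂ c₂ d₂) ⟩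
  parityℤ (minor r s X * (a₁ * d₁ - b₁ * c₁)) ≡⟨ cong (λ d → parityℤ (minor r s X * d)) det₁≡1 ⟩
  parityℤ (minor r s X * 1ℤ)                  ≡⟨ cong parityℤ (ℤ.*-identityʳ (minor r s X)) ⟩
  parityℤ (minor r s X)                       ≡⟨ parityℤ-minor r s X ⟩
  minor₂ r s (reduce X)                       ∎
  where open ≡-Reasoning
        ι₁₂ = ι a₁ b₁ c₁ d₁ a₂ b₂ c₂ d₂

invariant₂-·-Γdiag : ∀ X δ → InΓdiag δ → invariant₂ (reduce (X · δ)) ≡ invariant₂ (reduce X)
invariant₂-·-Γdiag X δ δ∈Γdiag =
  cong₂ _,_ (minor₂-·-Γdiag 0F 1F X δ δ∈Γdiag) (minor₂-·-Γdiag 2F 3F X δ δ∈Γdiag)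

blockDiagonalPart : Mat₂ → Mat₂
blockDiagonalPart P i j with block i Fin.≟ block j
... | yes _ = P i j
... | no  _ = 0ℙ

reduce-Γ₀⁰2 : ∀ γ → InΓ₀⁰2 γ → reduce γ ≈₂ blockDiagonalPart (reduce γ)
reduce-Γ₀⁰2 γ (_ , off-diagonal-even) i j with block i Fin.≟ block j
... | yes _   = refl
... | no  i≁j = 2∣⇒parityℤ≡0ℙ (γ i j) (off-diagonal-even i j i≁j)

blockMatrix₂ : (a b c d e f g h : Parity) → Mat₂
blockMatrix₂ a b c d e f g h i j = lookup (lookup rows i) j
  where
  rows : Vec (Vec Parity 4) 4
  rows = (a  ∷ b  ∷ 0ℙ ∷ 0ℙ ∷ [])
       ∷ (c  ∷ d  ∷ 0ℙ ∷ 0ℙ ∷ [])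
       ∷ (0ℙ ∷ 0ℙ ∷ e  ∷ f  ∷ [])
       ∷ (0ℙ ∷ 0ℙ ∷ g  ∷ h  ∷ [])
       ∷ []

-- The hypotheses say Aᵀ D = 1 for the diagonal blocks A and D, so that det A = det D = 1.
invariant₂-blockMatrix₂-⊙ : ∀ a b c d e f g h → let P = blockMatrix₂ a b c d e f g h in
  ω₂ (column₂ P 0F) (column₂ P 2F) ≡ 1ℙ → ω₂ (column₂ P 0F) (column₂ P 3F) ≡ 0ℙ →
  ω₂ (column₂ P 1F) (column₂ P 2F) ≡ 0ℙ → ω₂ (column₂ P 1F) (column₂ P 3F) ≡ 1ℙ →
  ∀ j → invariant₂ (P ⊙ reduce (rep j)) ≡ invariant₂ (reduce (rep j))
invariant₂-blockMatrix₂-⊙ = from-yes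
  (∀p λ a → ∀p λ b → ∀p λ c → ∀p λ d → ∀p λ e → ∀p λ f → ∀p λ g → ∀p λ h →
   let P = blockMatrix₂ a b c d e f g h in
   ω₂ (column₂ P 0F) (column₂ P 2F) ℙ.≟ 1ℙ →-dec ω₂ (column₂ P 0F) (column₂ P 3F) ℙ.≟ 0ℙ →-dec
   ω₂ (column₂ P 1F) (column₂ P 2F) ℙ.≟ 0ℙ →-dec ω₂ (column₂ P 1F) (column₂ P 3F) ℙ.≟ 1ℙ →-dec
   all? λ j → ≡-dec ℙ._≟_ ℙ._≟_ (invariant₂ (P ⊙ reduce (rep j))) (invariant₂ (reduce (rep j))))
  where ∀p = searchable-Parity

invariant₂-Γ₀⁰2-· : ∀ γ → InΓ₀⁰2 γ →
                    ∀ j → invariant₂ (reduce (γ · rep j)) ≡ invariant₂ (reduce (rep j))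
invariant₂-Γ₀⁰2-· γ γ∈Γ₀⁰2@(γ∈Sp , _) j = begin
  invariant₂ (reduce (γ · rep j))   ≡⟨ invariant₂-cong (reduce-· γ (rep j)) ⟩
  invariant₂ (P ⊙ reduce (rep j))   ≡⟨ invariant₂-cong (⊙-cong P≈P′ (≈₂-refl {reduce (rep j)})) ⟩
  invariant₂ (P′ ⊙ reduce (rep j))  ≡⟨ invariant₂-blockMatrix₂-⊙
                                         (P 0F 0F) (P 0F 1F) (P 1F 0F) (P 1F 1F)
                                         (P 2F 2F) (P 2F 3F) (P 3F 2F) (P 3F 3F)
                                         (ω′ 0F 2F) (ω′ 0F 3F) (ω′ 1F 2F) (ω′ 1F 3F) j ⟩
  invariant₂ (reduce (rep j))       ∎
  where
  open ≡-Reasoning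
  P = reduce γ
  P′ = blockDiagonalPart P
  P≈P′ = reduce-Γ₀⁰2 γ γ∈Γ₀⁰2
  ω′ : ∀ a b → ω₂ (column₂ P′ a) (column₂ P′ b) ≡ parityℤ (J a b)
  ω′ a b = trans (ω₂-cong (λ k → sym (P≈P′ k a)) (λ k → sym (P≈P′ k b))) (IsSp⇒ω₂ γ γ∈Sp a b)

rep-distinct : ∀ i j → SameDoubleCoset (rep i) (rep j) → i ≡ j
rep-distinct i j (γ , δ , γ∈Γ₀⁰2 , δ∈Γdiag , rep-i≈γ·rep-j·δ) = begin
  i                                    ≡⟨ repOf-invariant₂ i ⟨
  repOf (invariant₂ (reduce (rep i)))  ≡⟨ cong repOf invariants-agree ⟩
  repOf (invariant₂ (reduce (rep j)))  ≡⟨ repOf-invariant₂ j ⟩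
  j                                    ∎
  where
  open ≡-Reasoning
  invariants-agree : invariant₂ (reduce (rep i)) ≡ invariant₂ (reduce (rep j))
  invariants-agree = begin
    invariant₂ (reduce (rep i))          ≡⟨ invariant₂-cong (reduce-cong rep-i≈γ·rep-j·δ) ⟩
    invariant₂ (reduce (γ · rep j · δ))  ≡⟨ invariant₂-·-Γdiag (γ · rep j) δ δ∈Γdiag ⟩
    invariant₂ (reduce (γ · rep j))      ≡⟨ invariant₂-Γ₀⁰2-· γ γ∈Γ₀⁰2 j ⟩
    invariant₂ (reduce (rep j))          ∎

-- Every symplectic matrix lies in the double coset of a representative

record SL₂ : Set where
  constructor sl₂
  field
    a b c d : ℤ
    det≡1   : a * d - b * c ≡ 1ℤ

ιˢ : SL₂ → SL₂ → Mat
ιˢ (sl₂ a₁ b₁ c₁ d₁ _) (sl₂ a₂ b₂ c₂ d₂ _) = ι a₁ b₁ c₁ d₁ a₂ b₂ c₂ d₂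

ιˢ-InΓdiag : ∀ k₁ k₂ → InΓdiag (ιˢ k₁ k₂)
ιˢ-InΓdiag (sl₂ a₁ b₁ c₁ d₁ det₁≡1) (sl₂ a₂ b₂ c₂ d₂ det₂≡1) =
  a₁ , b₁ , c₁ , d₁ , a₂ , b₂ , c₂ , d₂ , det₁≡1 , det₂≡1 , ≈-refl

-- Lifts of the six elements of SL₂(𝔽₂).
SL₂-lift : Fin 6 → SL₂
SL₂-lift 0F = sl₂ (+ 1) (+ 0)   (+ 0)   (+ 1) refl
SL₂-lift 1F = sl₂ (+ 0) (- + 1) (+ 1)   (+ 0) refl
SL₂-lift 2F = sl₂ (+ 1) (+ 1)   (+ 0)   (+ 1) refl
SL₂-lift 3F = sl₂ (+ 1) (+ 0)   (+ 1)   (+ 1) refl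
SL₂-lift 4F = sl₂ (+ 0) (- + 1) (+ 1)   (+ 1) refl
SL₂-lift 5F = sl₂ (+ 1) (+ 1)   (- + 1) (+ 0) refl

δ-lift : Fin 6 → Fin 6 → Mat
δ-lift k₁ k₂ = ιˢ (SL₂-lift k₁) (SL₂-lift k₂)

swapBlocks : Fin 4 → Fin 4
swapBlocks 0F = 2F
swapBlocks 1F = 3F
swapBlocks 2F = 0F
swapBlocks 3F = 1F

-- (A B ; C D)⁻¹ = (Dᵀ -Bᵀ ; -Cᵀ Aᵀ) for symplectic (A B ; C D).
spInv : Mat → Mat
spInv M i j with block i Fin.≟ block j
... | yes _ = M (swapBlocks j) (swapBlocks i)
... | no  _ = - M (swapBlocks j) (swapBlocks i)

spInv₂ : Mat₂ → Mat₂
spInv₂ P i j = P (swapBlocks j) (swapBlocks i)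

reduce-spInv : ∀ M → reduce (spInv M) ≈₂ spInv₂ (reduce M)
reduce-spInv M i j with block i Fin.≟ block j
... | yes _ = refl
... | no  _ = parityℤ-neg (M (swapBlocks j) (swapBlocks i))

repδ : Fin 4 → Fin 6 → Fin 6 → Mat
repδ i k₁ k₂ = rep i · δ-lift k₁ k₂

repδ⁻¹ : Fin 4 → Fin 6 → Fin 6 → Mat
repδ⁻¹ i k₁ k₂ = spInv (repδ i k₁ k₂)

repδ⁻¹-valid : ∀ i k₁ k₂ → IsSp (repδ⁻¹ i k₁ k₂) × repδ⁻¹ i k₁ k₂ · repδ i k₁ k₂ ≈ 1₄
repδ⁻¹-valid = from-yes (all? λ i → all? λ k₁ → all? λ k₂ →
  IsSp? (repδ⁻¹ i k₁ k₂) ×-dec repδ⁻¹ i k₁ k₂ · repδ i k₁ k₂ ≈? 1₄)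

repδ⁻¹₂ : Fin 4 → Fin 6 → Fin 6 → Mat₂
repδ⁻¹₂ i k₁ k₂ = spInv₂ (reduce (rep i) ⊙ reduce (δ-lift k₁ k₂))

reduce-repδ⁻¹ : ∀ i k₁ k₂ → reduce (repδ⁻¹ i k₁ k₂) ≈₂ repδ⁻¹₂ i k₁ k₂
reduce-repδ⁻¹ i k₁ k₂ a b = trans (reduce-spInv (repδ i k₁ k₂) a b)
                                  (reduce-· (rep i) (δ-lift k₁ k₂) (swapBlocks b) (swapBlocks a))

BlockDiagonal₂ : Mat₂ → Set
BlockDiagonal₂ P = ∀ i j → ¬ block i ≡ block j → P i j ≡ 0ℙ

blockDiagonal₂? : ∀ P → Dec (BlockDiagonal₂ P)
blockDiagonal₂? P = all? λ i → all? λ j → ¬? (block i Fin.≟ block j) →-dec P i j ℙ.≟ 0ℙ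

-- The representative is predicted by the invariant, so only δ is searched for.
Covered : Mat₂ → Set
Covered P = ∃ λ k₁ → ∃ λ k₂ → BlockDiagonal₂ (P ⊙ repδ⁻¹₂ (repOf (invariant₂ P)) k₁ k₂)

covered? : ∀ P → Dec (Covered P)
covered? P =
  any? λ k₁ → any? λ k₂ → blockDiagonal₂? (P ⊙ repδ⁻¹₂ (repOf (invariant₂ P)) k₁ k₂)

fromColumns₂ : (c₀ c₁ c₂ c₃ : Vec Parity 4) → Mat₂
fromColumns₂ c₀ c₁ c₂ c₃ i 0F = lookup c₀ i
fromColumns₂ c₀ c₁ c₂ c₃ i 1F = lookup c₁ i
fromColumns₂ c₀ c₁ c₂ c₃ i 2F = lookup c₂ i
fromColumns₂ c₀ c₁ c₂ c₃ i 3F = lookup c₃ i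

-- Each quantifier is followed by the conditions on the columns chosen so far, so that the
-- search only extends partial symplectic bases.
Sp₂-covered : ∀ c₀ c₂ → ω₂ (lookup c₀) (lookup c₂) ≡ 1ℙ →
  ∀ c₁ → ω₂ (lookup c₀) (lookup c₁) ≡ 0ℙ → ω₂ (lookup c₂) (lookup c₁) ≡ 0ℙ →
  ∀ c₃ → ω₂ (lookup c₀) (lookup c₃) ≡ 0ℙ → ω₂ (lookup c₂) (lookup c₃) ≡ 0ℙ →
         ω₂ (lookup c₁) (lookup c₃) ≡ 1ℙ →
  Covered (fromColumns₂ c₀ c₁ c₂ c₃)
Sp₂-covered = from-yes
  (∀c λ c₀ → ∀c λ c₂ → ω₂ (lookup c₀) (lookup c₂) ℙ.≟ 1ℙ →-dec
   ∀c λ c₁ → ω₂ (lookup c₀) (lookup c₁) ℙ.≟ 0ℙ →-dec ω₂ (lookup c₂) (lookup c₁) ℙ.≟ 0ℙ →-dec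
   ∀c λ c₃ → ω₂ (lookup c₀) (lookup c₃) ℙ.≟ 0ℙ →-dec ω₂ (lookup c₂) (lookup c₃) ℙ.≟ 0ℙ →-dec
             ω₂ (lookup c₁) (lookup c₃) ℙ.≟ 1ℙ →-dec
   covered? (fromColumns₂ c₀ c₁ c₂ c₃))
  where ∀c = searchable-Vec 4 searchable-Parity

columnVec₂ : Mat → Fin 4 → Vec Parity 4
columnVec₂ g j = tabulate (column₂ (reduce g) j)

reduce-fromColumns₂ : ∀ g → reduce g ≈₂ fromColumns₂ (columnVec₂ g 0F) (columnVec₂ g 1F)
                                                     (columnVec₂ g 2F) (columnVec₂ g 3F)
reduce-fromColumns₂ g i 0F = sym (lookup∘tabulate (column₂ (reduce g) 0F) i)
reduce-fromColumns₂ g i 1F = sym (lookup∘tabulate (column₂ (reduce g) 1F) i)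
reduce-fromColumns₂ g i 2F = sym (lookup∘tabulate (column₂ (reduce g) 2F) i)
reduce-fromColumns₂ g i 3F = sym (lookup∘tabulate (column₂ (reduce g) 3F) i)

rep-exhaustive : ∀ g → IsSp g → ∃ λ i → SameDoubleCoset g (rep i)
rep-exhaustive g g∈Sp = fromCover (Sp₂-covered
  (c 0F) (c 2F) (ω′ 0F 2F) (c 1F) (ω′ 0F 1F) (ω′ 2F 1F) (c 3F) (ω′ 0F 3F) (ω′ 2F 3F) (ω′ 1F 3F))
  where
  c = columnVec₂ g
  ω′ = IsSp⇒ω₂ g g∈Sp
  P = fromColumns₂ (c 0F) (c 1F) (c 2F) (c 3F)

  fromCover : Covered P → ∃ λ i → SameDoubleCoset g (rep i)
  fromCover (k₁ , k₂ , P⊙N₂-blockDiagonal) =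
    i , g · N , δ , (IsSp-· g N g∈Sp (proj₁ (repδ⁻¹-valid i k₁ k₂)) , γ-even)
      , ιˢ-InΓdiag (SL₂-lift k₁) (SL₂-lift k₂) , g≈γ·rep-i·δ
    where
    i = repOf (invariant₂ P)
    N = repδ⁻¹ i k₁ k₂
    δ = δ-lift k₁ k₂

    γ-even : ∀ a b → ¬ block a ≡ block b → + 2 ∣ (g · N) a b
    γ-even a b a≁b = parityℤ≡0ℙ⇒2∣ ((g · N) a b) (begin
      parityℤ ((g · N) a b)        ≡⟨ reduce-· g N a b ⟩
      (reduce g ⊙ reduce N) a b    ≡⟨ ⊙-cong (reduce-fromColumns₂ g) (reduce-repδ⁻¹ i k₁ k₂) a b ⟩
      (P ⊙ repδ⁻¹₂ i k₁ k₂) a b    ≡⟨ P⊙N₂-blockDiagonal a b a≁b ⟩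
      0ℙ                           ∎)
      where open ≡-Reasoning

    g≈γ·rep-i·δ : g ≈ g · N · rep i · δ
    g≈γ·rep-i·δ = begin
      g                      ≈⟨ ·-identityʳ g ⟨
      g · 1₄                 ≈⟨ ·-cong (≈-refl {g}) (proj₂ (repδ⁻¹-valid i k₁ k₂)) ⟨
      g · (N · (rep i · δ))  ≈⟨ ·-assoc g N (rep i · δ) ⟨
      g · N · (rep i · δ)    ≈⟨ ·-assoc (g · N) (rep i) δ ⟨
      g · N · rep i · δ      ∎
      where open SetoidReasoning ≈-setoid

rep-IsSp : ∀ i → IsSp (rep i)
rep-IsSp = from-yes (all? λ i → IsSp? (rep i))

lemma7p1 : (∀ i → IsSp (rep i))
    × (∀ g → IsSp g → ∃ λ i → SameDoubleCoset g (rep i))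
    × (∀ i j → SameDoubleCoset (rep i) (rep j) → i ≡ j)
lemma7p1 = rep-IsSp , rep-exhaustive , rep-distinct
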